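{- The following are equivalent: (i) For any finite sets $\overline{x},\overline{y}$, the compact lifting of the inclusion homomorphism $i\colon\mathbf{F}(\overline{x})\hookrightarrow\mathbf{F}(\overline{x},\overline{y})$ has a right adjoint. (ii) For any finitely presented algebras $\mathbf A,\mathbf B$ in $\mathcal{V}$, the compact lifting of any homomorphism $f\colon\mathbf A\to\mathbf B$ has a right adjoint.
   Context: Fix an algebraic signature containing at least one constant symbol and a variety $\mathcal{V}$ of algebras in it. $\mathbf{F}(\overline{x})$ is the free algebra of $\mathcal V$ on variables $\overline{x}$; $\overline{x},\overline{y}$ are disjoint sets of variables and $\mathbf F(\overline{x},\overline{y})$ is the free algebra on their union. For a homomorphism $h\colon\mathbf A\to\mathbf B$, the compact lifting of $h$ is the map from the join-semilattice of compact (finitely generated) congruences of $\mathbf A$ (ordered by inclusion) to that of $\mathbf B$, sending $\psi$ to the congruence generated by $\{(h(a),h(a')):(a,a')\in\psi\}$. A map $f\colon P\to Q$ of posets has a right adjoint $g$ if $f(a)\le b\iff a\le g(b)$. An algebra $\mathbf A$ is finitely presented if there is a surjective homomorphism $p\colon\mathbf F(\overline{x})\to\mathbf A$ with $\overline{x}$ finite and $\ker p$ a compact congruence. -}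

module Defs where

open import Data.Nat using (ℕ; _+_)
open import Data.Fin using (Fin; _↑ˡ_)
open import Data.Product using (Σ; ∃; _×_; _,_; proj₁; proj₂)
open import Data.List using (List; map)
open import Data.List.Membership.Propositional using (_∈_)
open import Data.List.Membership.Propositional.Properties using (∈-map⁺; ∈-map⁻)
open import Relation.Binary.Core using (Rel)
open import Level using (0ℓ)
open import Relation.Binary.Structures using (IsEquivalence)
open import Relation.Binary.PropositionalEquality using (_≡_; refl)
open import Function using (_∘_)
open import Function.Bundles using (_⇔_)

record Signature : Set₁ where
  field
    Op    : Set
    arity : Op → ℕ

HasConstant : Signature → Set
HasConstant S = Σ (Signature.Op S) λ c → Signature.arity S c ≡ 0

module UA (S : Signature) where
  open Signature S

  data Term (X : Set) : Set where
    var  : X → Term X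
    node : (f : Op) → (Fin (arity f) → Term X) → Term X

  subst : {X Y : Set} → (X → Term Y) → Term X → Term Y
  subst σ (var x)     = σ x
  subst σ (node f ts) = node f (λ i → subst σ (ts i))

  rename : {X Y : Set} → (X → Y) → Term X → Term Y
  rename ρ = subst (var ∘ ρ)

  record Variety : Set₁ where
    field
      Eqn : Set
      lhs : Eqn → Term ℕ
      rhs : Eqn → Term ℕ

  record Algebra : Set₁ where
    field
      Carrier : Set
      _≈_     : Rel Carrier 0ℓ
      isEquiv : IsEquivalence _≈_
      op      : (f : Op) → (Fin (arity f) → Carrier) → Carrier
      op-cong : (f : Op) {as bs : Fin (arity f) → Carrier} →
                (∀ i → as i ≈ bs i) → op f as ≈ op f bs

  module _ (A : Algebra) where
    open Algebra A

    eval : {X : Set} → (X → Carrier) → Term X → Carrier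
    eval ρ (var x)     = ρ x
    eval ρ (node f ts) = op f (λ i → eval ρ (ts i))

  InV : Variety → Algebra → Set
  InV V A = ∀ (e : Eqn) (ρ : ℕ → Algebra.Carrier A) →
            Algebra._≈_ A (eval A ρ (lhs e)) (eval A ρ (rhs e))
    where open Variety V

  record Hom (A B : Algebra) : Set where
    private
      module A = Algebra A
      module B = Algebra B
    field
      fun     : A.Carrier → B.Carrier
      fun-cong : ∀ {a a'} → a A.≈ a' → fun a B.≈ fun a'
      fun-op  : (f : Op) (as : Fin (arity f) → A.Carrier) →
                fun (A.op f as) B.≈ B.op f (fun ∘ as)

  Surjective : {A B : Algebra} → Hom A B → Set
  Surjective {A} {B} h = ∀ b → ∃ λ a → Algebra._≈_ B (Hom.fun h a) b

  _⊆_ : {X : Set} → Rel X 0ℓ → Rel X 0ℓ → Set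
  R ⊆ T = ∀ {a b} → R a b → T a b

  module _ (A : Algebra) where
    open Algebra A

    data Cg (R : Rel Carrier 0ℓ) : Rel Carrier 0ℓ where
      cg-base  : ∀ {a b} → R a b → Cg R a b
      cg-eq    : ∀ {a b} → a ≈ b → Cg R a b
      cg-sym   : ∀ {a b} → Cg R a b → Cg R b a
      cg-trans : ∀ {a b c} → Cg R a b → Cg R b c → Cg R a c
      cg-op    : (f : Op) {as bs : Fin (arity f) → Carrier} →
                 (∀ i → Cg R (as i) (bs i)) → Cg R (op f as) (op f bs)

    ListRel : List (Carrier × Carrier) → Rel Carrier 0ℓ
    ListRel l a b = (a , b) ∈ l

    record CompCon : Set₁ where
      field
        rel    : Rel Carrier 0ℓ
        gens   : List (Carrier × Carrier)
        ⊆-gen  : rel ⊆ Cg (ListRel gens)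
        gen-⊆  : Cg (ListRel gens) ⊆ rel

  Ker : {A B : Algebra} → Hom A B → Rel (Algebra.Carrier A) 0ℓ
  Ker {B = B} h a a' = Algebra._≈_ B (Hom.fun h a) (Hom.fun h a')

  IsCompact : (A : Algebra) → Rel (Algebra.Carrier A) 0ℓ → Set
  IsCompact A R = Σ (List (Algebra.Carrier A × Algebra.Carrier A)) λ l →
                    (R ⊆ Cg A (ListRel A l)) × (Cg A (ListRel A l) ⊆ R)

  cg-rec : (A : Algebra) {R T : Rel (Algebra.Carrier A) 0ℓ} →
           R ⊆ Cg A T → Cg A R ⊆ Cg A T
  cg-rec A h (cg-base r)    = h r
  cg-rec A h (cg-eq e)      = cg-eq e
  cg-rec A h (cg-sym p)     = cg-sym (cg-rec A h p)
  cg-rec A h (cg-trans p q) = cg-trans (cg-rec A h p) (cg-rec A h q)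
  cg-rec A h (cg-op f ps)   = cg-op f (λ i → cg-rec A h (ps i))

  cg-map : {A B : Algebra} (h : Hom A B)
           {R : Rel (Algebra.Carrier A) 0ℓ} {T : Rel (Algebra.Carrier B) 0ℓ} →
           (∀ {a a'} → R a a' → T (Hom.fun h a) (Hom.fun h a')) →
           ∀ {a a'} → Cg A R a a' → Cg B T (Hom.fun h a) (Hom.fun h a')
  cg-map h k (cg-base r)    = cg-base (k r)
  cg-map h k (cg-eq e)      = cg-eq (Hom.fun-cong h e)
  cg-map h k (cg-sym p)     = cg-sym (cg-map h k p)
  cg-map h k (cg-trans p q) = cg-trans (cg-map h k p) (cg-map h k q)
  cg-map {A} {B} h k (cg-op f {as} {bs} ps) =
    cg-trans (cg-eq (Hom.fun-op h f as))
      (cg-trans (cg-op f (λ i → cg-map h k (ps i)))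
                (cg-eq (IsEquivalence.sym (Algebra.isEquiv B) (Hom.fun-op h f bs))))

  Img : {A B : Algebra} → Hom A B → Rel (Algebra.Carrier A) 0ℓ →
        Rel (Algebra.Carrier B) 0ℓ
  Img {A} {B} h R b b' = Σ (Algebra.Carrier A) λ a → Σ (Algebra.Carrier A) λ a' →
      R a a' × (Algebra._≈_ B (Hom.fun h a) b × Algebra._≈_ B (Hom.fun h a') b')

  lift : {A B : Algebra} → Hom A B → CompCon A → CompCon B
  lift {A} {B} h ψ = record
    { rel   = Cg B (Img h (CompCon.rel ψ))
    ; gens  = map hh (CompCon.gens ψ)
    ; ⊆-gen = cg-rec B step₁
    ; gen-⊆ = cg-rec B step₂
    }
    where
    module B = Algebra B
    open IsEquivalence B.isEquiv using () renaming (sym to B-sym; refl to B-refl)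
    hh : Algebra.Carrier A × Algebra.Carrier A → B.Carrier × B.Carrier
    hh (a , a') = Hom.fun h a , Hom.fun h a'
    step₁ : Img h (CompCon.rel ψ) ⊆ Cg B (ListRel B (map hh (CompCon.gens ψ)))
    step₁ (a , a' , r , e , e') =
      cg-trans (cg-eq (B-sym e))
        (cg-trans (cg-map h (λ m → ∈-map⁺ hh m) (CompCon.⊆-gen ψ r)) (cg-eq e'))
    step₂ : ListRel B (map hh (CompCon.gens ψ)) ⊆ Cg B (Img h (CompCon.rel ψ))
    step₂ m with ∈-map⁻ hh m
    ... | (a , a') , m' , refl =
      cg-base (a , a' , CompCon.gen-⊆ ψ (cg-base m') , B-refl , B-refl)

  HasRightAdjoint : {A B : Algebra} → Hom A B → Set₁
  HasRightAdjoint {A} {B} h =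
    Σ (CompCon B → CompCon A) λ g → ∀ (ψ : CompCon A) (φ : CompCon B) →
      (CompCon.rel (lift h ψ) ⊆ CompCon.rel φ) ⇔ (CompCon.rel ψ ⊆ CompCon.rel (g φ))

  module _ (V : Variety) where
    open Variety V

    data _≐_ {X : Set} : Term X → Term X → Set where
      ax    : (e : Eqn) (σ : ℕ → Term X) → subst σ (lhs e) ≐ subst σ (rhs e)
      ≐refl : ∀ {t} → t ≐ t
      ≐sym  : ∀ {s t} → s ≐ t → t ≐ s
      ≐tr   : ∀ {s t u} → s ≐ t → t ≐ u → s ≐ u
      ≐cong : (f : Op) {ss ts : Fin (arity f) → Term X} →
              (∀ i → ss i ≐ ts i) → node f ss ≐ node f ts

    F : ℕ → Algebra
    F n = record
      { Carrier = Term (Fin n)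
      ; _≈_     = _≐_
      ; isEquiv = record { refl = ≐refl ; sym = ≐sym ; trans = ≐tr }
      ; op      = node
      ; op-cong = ≐cong
      }

    ren-subst : {X Y : Set} (ρ : X → Y) (σ : ℕ → Term X) (t : Term ℕ) →
                rename ρ (subst σ t) ≐ subst (rename ρ ∘ σ) t
    ren-subst ρ σ (var x)     = ≐refl
    ren-subst ρ σ (node f ts) = ≐cong f (λ i → ren-subst ρ σ (ts i))

    ren-cong : {X Y : Set} (ρ : X → Y) {s t : Term X} → s ≐ t → rename ρ s ≐ rename ρ t
    ren-cong ρ (ax e σ)    = ≐tr (ren-subst ρ σ (lhs e))
                               (≐tr (ax e (rename ρ ∘ σ)) (≐sym (ren-subst ρ σ (rhs e))))
    ren-cong ρ ≐refl       = ≐refl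
    ren-cong ρ (≐sym p)    = ≐sym (ren-cong ρ p)
    ren-cong ρ (≐tr p q)   = ≐tr (ren-cong ρ p) (ren-cong ρ q)
    ren-cong ρ (≐cong f ps) = ≐cong f (λ i → ren-cong ρ (ps i))

    -- the inclusion F(x̄) ↪ F(x̄, ȳ), with x̄ = Fin n, ȳ = Fin m (disjoint),
    -- x̄ ∪ ȳ = Fin (n + m)
    incl : (n m : ℕ) → Hom (F n) (F (n + m))
    incl n m = record
      { fun      = rename (_↑ˡ m)
      ; fun-cong = ren-cong (_↑ˡ m)
      ; fun-op   = λ f as → ≐refl
      }

    FinitelyPresented : Algebra → Set
    FinitelyPresented A = Σ ℕ λ n → Σ (Hom (F n) A) λ p →
      Surjective p × IsCompact (F n) (Ker p)

    CondI : Set₁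
    CondI = ∀ (n m : ℕ) → HasRightAdjoint (incl n m)

    CondII : Set₁
    CondII = ∀ (A B : Algebra) → InV V A → InV V B →
             FinitelyPresented A → FinitelyPresented B →
             ∀ (f : Hom A B) → HasRightAdjoint f

-- The compact lifting of any h is left adjoint to the preimage map φ ↦ h⁻¹(φ) on all
-- congruences, so it has a right adjoint on compact congruences as soon as preimages of
-- compact congruences are compact; this holds along surjections with compact kernel.
-- Given f : A → B between algebras presented by p : F(x̄) → A and q : F(ȳ) → B, the map
-- h : F(x̄, ȳ) → B sending x̄ to (chosen q-preimages of) f ∘ p and ȳ via q is such a
-- surjection and h ∘ i = f ∘ p.  Chasing this square, the right adjoint of the lifting of
-- the inclusion i yields one for f, namely φ ↦ p(G(h⁻¹(φ))).  Conversely free algebras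
-- on finitely many generators are finitely presented.

module Submission where

open import Defs
open import Data.Nat using (ℕ; _+_)
open import Data.Fin using (Fin; _↑ˡ_; _↑ʳ_; splitAt)
open import Data.Fin.Properties using (splitAt-↑ˡ; splitAt-↑ʳ)
open import Data.Sum using ([_,_]′; inj₁; inj₂)
open import Data.Product using (_×_; _,_; proj₁; proj₂)
open import Data.List using ([]; map; _++_; allFin)
open import Data.List.Membership.Propositional.Properties
  using (∈-map⁺; ∈-map⁻; ∈-++⁺ˡ; ∈-++⁺ʳ; ∈-++⁻; ∈-allFin)
open import Relation.Binary.Core using (Rel)
open import Relation.Binary.Structures using (IsEquivalence)
open import Relation.Binary.PropositionalEquality using (refl)
open import Level using (0ℓ)
open import Function using (_∘_; id)
open import Function.Bundles using (_⇔_; mk⇔; Equivalence)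

module _ (S : Signature) where
  open Signature S
  open UA S

  IsCongruence : (A : Algebra) → Rel (Algebra.Carrier A) 0ℓ → Set
  IsCongruence A R = Cg A R ⊆ R

  CompCon-isCongruence : (A : Algebra) (φ : CompCon A) → IsCongruence A (CompCon.rel φ)
  CompCon-isCongruence A φ r = CompCon.gen-⊆ φ (cg-rec A (CompCon.⊆-gen φ) r)

  congruence-resp-≈ : (A : Algebra) {R : Rel (Algebra.Carrier A) 0ℓ} → IsCongruence A R →
                      ∀ {a b a' b'} → Algebra._≈_ A a a' → Algebra._≈_ A b b' → R a b → R a' b'
  congruence-resp-≈ A R-cong e e' r =
    R-cong (cg-trans (cg-eq (IsEquivalence.sym (Algebra.isEquiv A) e))
                     (cg-trans (cg-base r) (cg-eq e')))

  ≈-isCongruence : (A : Algebra) → IsCongruence A (Algebra._≈_ A)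
  ≈-isCongruence A (cg-base e)    = e
  ≈-isCongruence A (cg-eq e)      = e
  ≈-isCongruence A (cg-sym p)     = IsEquivalence.sym (Algebra.isEquiv A) (≈-isCongruence A p)
  ≈-isCongruence A (cg-trans p q) =
    IsEquivalence.trans (Algebra.isEquiv A) (≈-isCongruence A p) (≈-isCongruence A q)
  ≈-isCongruence A (cg-op f ps)   = Algebra.op-cong A f (λ i → ≈-isCongruence A (ps i))

  idₕ : {A : Algebra} → Hom A A
  idₕ {A} = record
    { fun = id ; fun-cong = id ; fun-op = λ _ _ → IsEquivalence.refl (Algebra.isEquiv A) }

  _∘ₕ_ : {A B C : Algebra} → Hom B C → Hom A B → Hom A C
  _∘ₕ_ {C = C} v u = record
    { fun      = Hom.fun v ∘ Hom.fun u
    ; fun-cong = Hom.fun-cong v ∘ Hom.fun-cong u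
    ; fun-op   = λ f as → IsEquivalence.trans (Algebra.isEquiv C)
                   (Hom.fun-cong v (Hom.fun-op u f as)) (Hom.fun-op v f (Hom.fun u ∘ as))
    }

  Preimage : {A B : Algebra} → Hom A B → Rel (Algebra.Carrier B) 0ℓ → Rel (Algebra.Carrier A) 0ℓ
  Preimage h T a a' = T (Hom.fun h a) (Hom.fun h a')

  Preimage-isCongruence : {A B : Algebra} (h : Hom A B) {T : Rel (Algebra.Carrier B) 0ℓ} →
                          IsCongruence B T → IsCongruence A (Preimage h T)
  Preimage-isCongruence h T-cong r = T-cong (cg-map h id r)

  Cg-Img⊆⇔⊆Preimage : {A B : Algebra} (h : Hom A B) {R : Rel (Algebra.Carrier A) 0ℓ}
                      {T : Rel (Algebra.Carrier B) 0ℓ} → IsCongruence B T →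
                      (Cg B (Img h R) ⊆ T) ⇔ (R ⊆ Preimage h T)
  Cg-Img⊆⇔⊆Preimage {B = B} h T-cong = mk⇔
    (λ H {_} {_} r → H (cg-base (_ , _ , r , B-refl , B-refl)))
    (λ H {_} {_} r → T-cong (cg-rec B (λ { (_ , _ , r' , e , e') →
                                   cg-base (congruence-resp-≈ B T-cong e e' (H r')) }) r))
    where open IsEquivalence (Algebra.isEquiv B) using () renaming (refl to B-refl)

  ⊆-Img-Preimage : {A B : Algebra} (h : Hom A B) → Surjective h →
                   {R : Rel (Algebra.Carrier B) 0ℓ} → IsCongruence B R → R ⊆ Img h (Preimage h R)
  ⊆-Img-Preimage {B = B} h surj R-cong {b} {b'} r =
    s , s' , congruence-resp-≈ B R-cong (B-sym e) (B-sym e') r , e , e'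
    where
    open IsEquivalence (Algebra.isEquiv B) using () renaming (sym to B-sym)
    s = proj₁ (surj b)
    s' = proj₁ (surj b')
    e = proj₂ (surj b)
    e' = proj₂ (surj b')

  module _ {C D : Algebra} (p : Hom C D) (surj : Surjective p) where
    private
      module D = Algebra D
      open IsEquivalence D.isEquiv using ()
        renaming (sym to D-sym; trans to D-trans; refl to D-refl)
      pick : D.Carrier → Algebra.Carrier C
      pick b = proj₁ (surj b)
      pick-≈ : ∀ b → Hom.fun p (pick b) D.≈ b
      pick-≈ b = proj₂ (surj b)

    Reflects : Rel (Algebra.Carrier C) 0ℓ → Rel D.Carrier 0ℓ → Set
    Reflects R T = ∀ {b b'} → T b b' → ∀ {s s'} →
                   Hom.fun p s D.≈ b → Hom.fun p s' D.≈ b' → Cg C R s s'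

    -- Every step of a derivation in Cg D T is pulled back through chosen preimages; the
    -- kernel absorbs the discrepancy between a chosen preimage and the given one.
    Cg-reflects : {R : Rel (Algebra.Carrier C) 0ℓ} → Ker p ⊆ Cg C R →
                  {T : Rel D.Carrier 0ℓ} → Reflects R T → Reflects R (Cg D T)
    Cg-reflects ker⊆ hT (cg-base t) e e' = hT t e e'
    Cg-reflects ker⊆ hT (cg-eq x) e e' = ker⊆ (D-trans e (D-trans x (D-sym e')))
    Cg-reflects ker⊆ hT (cg-sym q) e e' = cg-sym (Cg-reflects ker⊆ hT q e' e)
    Cg-reflects ker⊆ hT (cg-trans {b = c} q r) e e' =
      cg-trans (Cg-reflects ker⊆ hT q e (pick-≈ c)) (Cg-reflects ker⊆ hT r (pick-≈ c) e')
    Cg-reflects ker⊆ hT (cg-op f {as} {bs} qs) {s} {s'} e e' =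
      cg-trans (ker⊆ (D-trans e (D-sym p-op-as)))
        (cg-trans (cg-op f (λ i → Cg-reflects ker⊆ hT (qs i) (pick-≈ (as i)) (pick-≈ (bs i))))
                  (ker⊆ (D-trans p-op-bs (D-sym e'))))
      where
      p-op-as : Hom.fun p (Algebra.op C f (pick ∘ as)) D.≈ D.op f as
      p-op-as = D-trans (Hom.fun-op p f (pick ∘ as)) (D.op-cong f (pick-≈ ∘ as))
      p-op-bs : Hom.fun p (Algebra.op C f (pick ∘ bs)) D.≈ D.op f bs
      p-op-bs = D-trans (Hom.fun-op p f (pick ∘ bs)) (D.op-cong f (pick-≈ ∘ bs))

    -- p⁻¹(φ) is generated by the kernel generators together with preimages of φ's generators.
    preimage : IsCompact C (Ker p) → CompCon D → CompCon C
    preimage (L , ker⊆L , L⊆ker) φ = record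
      { rel   = Preimage p (CompCon.rel φ)
      ; gens  = K
      ; ⊆-gen = λ r → Cg-reflects ker⊆K gens-reflect (CompCon.⊆-gen φ r) D-refl D-refl
      ; gen-⊆ = λ r → Preimage-isCongruence p φ-cong (cg-rec C (λ m → cg-base (K⊆ m)) r)
      }
      where
      φ-cong = CompCon-isCongruence D φ
      pick² : D.Carrier × D.Carrier → Algebra.Carrier C × Algebra.Carrier C
      pick² (b , b') = pick b , pick b'
      K = L ++ map pick² (CompCon.gens φ)
      ker⊆K : Ker p ⊆ Cg C (ListRel C K)
      ker⊆K e = cg-rec C (λ m → cg-base (∈-++⁺ˡ m)) (ker⊆L e)
      gens-reflect : Reflects (ListRel C K) (ListRel D (CompCon.gens φ))
      gens-reflect {b} {b'} m e e' =
        cg-trans (ker⊆K (D-trans e (D-sym (pick-≈ b))))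
          (cg-trans (cg-base (∈-++⁺ʳ L (∈-map⁺ pick² m)))
                    (ker⊆K (D-trans (pick-≈ b') (D-sym e'))))
      K⊆ : ListRel C K ⊆ Preimage p (CompCon.rel φ)
      K⊆ m with ∈-++⁻ L m
      ... | inj₁ m₁ = φ-cong (cg-eq (L⊆ker (cg-base m₁)))
      ... | inj₂ m₂ with ∈-map⁻ pick² m₂
      ... | (b , b') , m₃ , refl =
        congruence-resp-≈ D φ-cong (D-sym (pick-≈ b)) (D-sym (pick-≈ b'))
          (CompCon.gen-⊆ φ (cg-base m₃))

  HasRightAdjoint-square :
    {A B C D : Algebra} (f : Hom A B) (p : Hom C A) (k : Hom C D) (h : Hom D B) →
    (∀ s → Algebra._≈_ B (Hom.fun h (Hom.fun k s)) (Hom.fun f (Hom.fun p s))) →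
    Surjective p → IsCompact C (Ker p) → Surjective h → IsCompact D (Ker h) →
    HasRightAdjoint k → HasRightAdjoint f
  HasRightAdjoint-square {A} {B} {C} {D} f p k h square p-surj p-ker h-surj h-ker (G , G-adj) =
    g , λ ψ φ → mk⇔ (to ψ φ) (from ψ φ)
    where
    open IsEquivalence (Algebra.isEquiv B) using () renaming (sym to B-sym)
    rel = CompCon.rel
    h⁻¹ : CompCon B → CompCon D
    h⁻¹ = preimage h h-surj h-ker
    g : CompCon B → CompCon A
    g φ = lift p (G (h⁻¹ φ))

    lift⊣ : {X Y : Algebra} (u : Hom X Y) (ψ : CompCon X) (φ : CompCon Y) →
            (rel (lift u ψ) ⊆ rel φ) ⇔ (rel ψ ⊆ Preimage u (rel φ))
    lift⊣ {Y = Y} u ψ φ = Cg-Img⊆⇔⊆Preimage u (CompCon-isCongruence Y φ)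

    module _ (φ : CompCon B) where
      φ-cong = CompCon-isCongruence B φ

      fp⇒hk : Preimage p (Preimage f (rel φ)) ⊆ Preimage k (rel (h⁻¹ φ))
      fp⇒hk {s} {s'} = congruence-resp-≈ B φ-cong (B-sym (square s)) (B-sym (square s'))

      hk⇒fp : Preimage k (rel (h⁻¹ φ)) ⊆ Preimage p (Preimage f (rel φ))
      hk⇒fp {s} {s'} = congruence-resp-≈ B φ-cong (square s) (square s')

    to : ∀ ψ φ → rel (lift f ψ) ⊆ rel φ → rel ψ ⊆ rel (g φ)
    to ψ φ H r with ⊆-Img-Preimage p p-surj (CompCon-isCongruence A ψ) r
    ... | s , s' , r' , e , e' = cg-base (s , s' , p⁻¹ψ⊆G r' , e , e')
      where
      p⁻¹ψ = preimage p p-surj p-ker ψ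
      p⁻¹ψ⊆G : rel p⁻¹ψ ⊆ rel (G (h⁻¹ φ))
      p⁻¹ψ⊆G = Equivalence.to (G-adj p⁻¹ψ (h⁻¹ φ))
        (Equivalence.from (lift⊣ k p⁻¹ψ (h⁻¹ φ))
          (fp⇒hk φ ∘ Equivalence.to (lift⊣ f ψ φ) H))

    from : ∀ ψ φ → rel ψ ⊆ rel (g φ) → rel (lift f ψ) ⊆ rel φ
    from ψ φ H = Equivalence.from (lift⊣ f ψ φ) (lift-p-G⊆ ∘ H)
      where
      G⊆ : rel (G (h⁻¹ φ)) ⊆ Preimage p (Preimage f (rel φ))
      G⊆ = hk⇒fp φ ∘ Equivalence.to (lift⊣ k (G (h⁻¹ φ)) (h⁻¹ φ))
             (Equivalence.from (G-adj (G (h⁻¹ φ)) (h⁻¹ φ)) id)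
      lift-p-G⊆ : rel (g φ) ⊆ Preimage f (rel φ)
      lift-p-G⊆ = Equivalence.from
        (Cg-Img⊆⇔⊆Preimage p (Preimage-isCongruence f (CompCon-isCongruence B φ))) G⊆

  module _ (V : Variety) where
    open Variety V

    infix 4 _≐ᵥ_
    _≐ᵥ_ : {X : Set} → Term X → Term X → Set
    _≐ᵥ_ = _≐_ V

    subst-subst : {Y Z : Set} (σ : Y → Term Z) (τ : ℕ → Term Y) (t : Term ℕ) →
                  subst σ (subst τ t) ≐ᵥ subst (subst σ ∘ τ) t
    subst-subst σ τ (var x)     = ≐refl
    subst-subst σ τ (node f ts) = ≐cong f (λ i → subst-subst σ τ (ts i))

    subst-cong : {X Y : Set} (σ : X → Term Y) {s t : Term X} → s ≐ᵥ t → subst σ s ≐ᵥ subst σ t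
    subst-cong σ (ax e τ)     = ≐tr (subst-subst σ τ (lhs e))
                                  (≐tr (ax e (subst σ ∘ τ)) (≐sym (subst-subst σ τ (rhs e))))
    subst-cong σ ≐refl        = ≐refl
    subst-cong σ (≐sym p)     = ≐sym (subst-cong σ p)
    subst-cong σ (≐tr p q)    = ≐tr (subst-cong σ p) (subst-cong σ q)
    subst-cong σ (≐cong f ps) = ≐cong f (λ i → subst-cong σ (ps i))

    substHom : {k l : ℕ} → (Fin k → Term (Fin l)) → Hom (F V k) (F V l)
    substHom σ = record { fun = subst σ ; fun-cong = subst-cong σ ; fun-op = λ _ _ → ≐refl }

    F-homs-agree : {k : ℕ} {B : Algebra} (u v : Hom (F V k) B) →
                   (∀ i → Algebra._≈_ B (Hom.fun u (var i)) (Hom.fun v (var i))) →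
                   ∀ t → Algebra._≈_ B (Hom.fun u t) (Hom.fun v t)
    F-homs-agree u v agree (var i)     = agree i
    F-homs-agree {B = B} u v agree (node f ts) =
      trans (Hom.fun-op u f ts)
        (trans (Algebra.op-cong B f (λ i → F-homs-agree u v agree (ts i)))
               (sym (Hom.fun-op v f ts)))
      where open IsEquivalence (Algebra.isEquiv B)

    eval-F : {k : ℕ} (ρ : ℕ → Term (Fin k)) (t : Term ℕ) → eval (F V k) ρ t ≐ᵥ subst ρ t
    eval-F ρ (var x)     = ≐refl
    eval-F ρ (node f ts) = ≐cong f (λ i → eval-F ρ (ts i))

    F-inV : (k : ℕ) → InV V (F V k)
    F-inV k e ρ = ≐tr (eval-F ρ (lhs e)) (≐tr (ax e ρ) (≐sym (eval-F ρ (rhs e))))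

    Cg-[]⊆≐ : {k : ℕ} → Cg (F V k) (ListRel (F V k) []) ⊆ _≐ᵥ_
    Cg-[]⊆≐ (cg-base ())
    Cg-[]⊆≐ (cg-eq e)       = e
    Cg-[]⊆≐ (cg-sym p)      = ≐sym (Cg-[]⊆≐ p)
    Cg-[]⊆≐ (cg-trans p q)  = ≐tr (Cg-[]⊆≐ p) (Cg-[]⊆≐ q)
    Cg-[]⊆≐ (cg-op f ps)    = ≐cong f (λ i → Cg-[]⊆≐ (ps i))

    F-finitelyPresented : (k : ℕ) → FinitelyPresented V (F V k)
    F-finitelyPresented k = k , idₕ , (λ t → t , ≐refl) , [] , cg-eq , Cg-[]⊆≐

    -- h sends xᵢ to q(t i) and ȳ via q; its kernel is generated by xᵢ ≡ t i and ι(ker q).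
    module ExtendPresentation {m : ℕ} {B : Algebra} (q : Hom (F V m) B) (q-surj : Surjective q)
                              (q-ker : IsCompact (F V m) (Ker q)) {n : ℕ} (t : Fin n → Term (Fin m))
                              where
      private
        open IsEquivalence (Algebra.isEquiv B) using () renaming (sym to B-sym; trans to B-trans)
        Lq = proj₁ q-ker
        σv : Fin (n + m) → Term (Fin m)
        σv k = [ t , var ]′ (splitAt n k)
        σ : Hom (F V (n + m)) (F V m)
        σ = substHom σv
        ι : Hom (F V m) (F V (n + m))
        ι = substHom (var ∘ (n ↑ʳ_))

        σ∘ι≐id : ∀ u → Hom.fun σ (Hom.fun ι u) ≐ᵥ u
        σ∘ι≐id (var j) rewrite splitAt-↑ʳ n m j = ≐refl
        σ∘ι≐id (node g us) = ≐cong g (λ i → σ∘ι≐id (us i))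

      h : Hom (F V (n + m)) B
      h = q ∘ₕ σ

      private
        h∘ι≈q : ∀ u → Algebra._≈_ B (Hom.fun h (Hom.fun ι u)) (Hom.fun q u)
        h∘ι≈q u = Hom.fun-cong q (σ∘ι≐id u)

        var-pair : Fin (n + m) → Term (Fin (n + m)) × Term (Fin (n + m))
        var-pair k = var k , Hom.fun ι (σv k)
        ι² : Term (Fin m) × Term (Fin m) → Term (Fin (n + m)) × Term (Fin (n + m))
        ι² (u , u') = Hom.fun ι u , Hom.fun ι u'
        L = map var-pair (allFin (n + m)) ++ map ι² Lq
        CgL = Cg (F V (n + m)) (ListRel (F V (n + m)) L)

        L⊆ker : ListRel (F V (n + m)) L ⊆ Ker h
        L⊆ker mem with ∈-++⁻ (map var-pair (allFin (n + m))) mem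
        ... | inj₁ m₁ with ∈-map⁻ var-pair m₁
        ... | k , _ , refl = B-sym (h∘ι≈q (σv k))
        L⊆ker mem | inj₂ m₂ with ∈-map⁻ ι² m₂
        ... | (u , u') , m₃ , refl =
          B-trans (h∘ι≈q u) (B-trans (proj₂ (proj₂ q-ker) (cg-base m₃)) (B-sym (h∘ι≈q u')))

        to-ι∘σ : ∀ s → CgL s (Hom.fun ι (Hom.fun σ s))
        to-ι∘σ (var k)     = cg-base (∈-++⁺ˡ (∈-map⁺ var-pair (∈-allFin k)))
        to-ι∘σ (node g ts) = cg-op g (λ i → to-ι∘σ (ts i))

        ker⊆L : Ker h ⊆ CgL
        ker⊆L {s} {s'} e =
          cg-trans (to-ι∘σ s)
            (cg-trans (cg-map ι (λ m' → ∈-++⁺ʳ (map var-pair (allFin (n + m))) (∈-map⁺ ι² m'))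
                        (proj₁ (proj₂ q-ker) e))
                      (cg-sym (to-ι∘σ s')))

      h-surjective : Surjective h
      h-surjective b = Hom.fun ι (proj₁ (q-surj b)) , B-trans (h∘ι≈q _) (proj₂ (q-surj b))

      h-ker-compact : IsCompact (F V (n + m)) (Ker h)
      h-ker-compact = L , ker⊆L , λ r →
        Preimage-isCongruence h (≈-isCongruence B)
          (cg-rec (F V (n + m)) (λ m' → cg-base (L⊆ker m')) r)

      h-left : ∀ i → Algebra._≈_ B (Hom.fun h (var (i ↑ˡ m))) (Hom.fun q (t i))
      h-left i rewrite splitAt-↑ˡ n i m = Hom.fun-cong q ≐refl

    i⇒ii : CondI V → CondII V
    i⇒ii cI A B _ _ (n , p , p-surj , p-ker) (m , q , q-surj , q-ker) f =
      HasRightAdjoint-square f p (incl V n m) h square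
        p-surj p-ker h-surjective h-ker-compact (cI n m)
      where
      open ExtendPresentation q q-surj q-ker (λ i → proj₁ (q-surj (Hom.fun f (Hom.fun p (var i)))))
      square : ∀ s → Algebra._≈_ B (Hom.fun h (Hom.fun (incl V n m) s)) (Hom.fun f (Hom.fun p s))
      square = F-homs-agree (h ∘ₕ incl V n m) (f ∘ₕ p) λ i →
        IsEquivalence.trans (Algebra.isEquiv B) (h-left i) (proj₂ (q-surj _))

    ii⇒i : CondII V → CondI V
    ii⇒i cII n m = cII (F V n) (F V (n + m)) (F-inV n) (F-inV (n + m))
                       (F-finitelyPresented n) (F-finitelyPresented (n + m)) (incl V n m)

-- The argument never needs a nonempty algebra.
proposition3p8 : (S : Signature) → HasConstant S → (V : UA.Variety S) →
    UA.CondI S V ⇔ UA.CondII S V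
proposition3p8 S _ V = mk⇔ (i⇒ii S V) (ii⇒i S V)
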